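{- Let $\Gamma$ be a finite, undirected, simple, connected graph on $2m$ vertices with a permutable perfect matching $\mathcal{M}$. Then $\Gamma$ is one of $K_{2m}$, $K_m \vee \overline{K}_m$, $K_{m,m}$, $K_m \veebar K_m$, $K_m \veebar \overline{K}_m$, $C_6$, or $K_6$ minus a perfect matching ($\cong K_{2,2,2}$).
   Context: A perfect matching is a set of edges such that every vertex lies in exactly one of them. A matching $\mathcal{M}$ with $m$ edges is permutable if there is $G \le \operatorname{Aut}(\Gamma)$ whose setwise stabilizer $G_{\mathcal{M}}$ induces the full symmetric group $S_m$ on the edges of $\mathcal{M}$. $\overline{K}_m$ is the edgeless graph on $m$ vertices. The join $\Gamma_1 \vee \Gamma_2$ is the disjoint union of $\Gamma_1,\Gamma_2$ plus all edges between $V(\Gamma_1)$ and $V(\Gamma_2)$. For $|V(\Gamma_1)|=|V(\Gamma_2)|$, $\Gamma_1 \veebar \Gamma_2$ is the disjoint union of $\Gamma_1,\Gamma_2$ plus a perfect matching between $V(\Gamma_1)$ and $V(\Gamma_2)$ (well defined up to isomorphism when one of the graphs is complete or edgeless). -}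

module Defs where

open import Data.Nat using (ℕ; zero; suc; _+_; _/_)
open import Data.Empty using (⊥-elim)
open import Data.Bool.Properties using (∧-zeroʳ; ∨-comm)
open import Data.Bool using (Bool; true; false; not; _∨_; _∧_)
open import Data.Fin using (Fin; toℕ; zero; suc)
open import Data.Fin.Properties using (_≟_)
open import Data.Nat.Properties using () renaming (_≟_ to _≟ℕ_)
open import Data.Nat.DivMod using (_%_)
open import Data.Sum using (_⊎_; inj₁; inj₂)
open import Data.Product using (Σ; _×_; _,_)
open import Relation.Nullary using (does; yes; no)
open import Relation.Binary.PropositionalEquality using (_≡_; refl; cong) renaming (sym to ≡-sym)
open import Function.Bundles using (_↔_; Inverse)
open import Data.Fin.Permutation using (Permutation′; _⟨$⟩ʳ_; _∘ₚ_; flip)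
  renaming (id to idₚ)

record Graph (V : Set) : Set where
  field
    adj    : V → V → Bool
    sym    : ∀ u v → adj u v ≡ adj v u
    irrefl : ∀ v → adj v v ≡ false
open Graph public

_≅_ : {V W : Set} → Graph V → Graph W → Set
_≅_ {V} {W} G H =
  Σ (V ↔ W) λ f → ∀ u v → adj H (Inverse.to f u) (Inverse.to f v) ≡ adj G u v

data Reach {V : Set} (G : Graph V) : V → V → Set where
  here : ∀ {v} → Reach G v v
  step : ∀ {u w v} → adj G u w ≡ true → Reach G w v → Reach G u v

Connected : {V : Set} → Graph V → Set
Connected {V} G = ∀ (u v : V) → Reach G u v

record PerfectMatching {n : ℕ} (Γ : Graph (Fin n)) (k : ℕ) : Set where
  field
    end₁ end₂ : Fin k → Fin n
    isEdge    : ∀ i → adj Γ (end₁ i) (end₂ i) ≡ true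
  Incident : Fin n → Fin k → Set
  Incident v i = (v ≡ end₁ i) ⊎ (v ≡ end₂ i)
  field
    cover : ∀ v → Σ (Fin k) λ i → Incident v i × (∀ j → Incident v j → j ≡ i)
open PerfectMatching public

IsAut : {n : ℕ} → Graph (Fin n) → Permutation′ n → Set
IsAut Γ g = ∀ u v → adj Γ (g ⟨$⟩ʳ u) (g ⟨$⟩ʳ v) ≡ adj Γ u v

record IsAutSubgroup {n : ℕ} (Γ : Graph (Fin n)) (G : Permutation′ n → Set) : Set where
  field
    ⊆Aut  : ∀ g → G g → IsAut Γ g
    hasId : G idₚ
    ∘-closed : ∀ g h → G g → G h → G (g ∘ₚ h)
    ⁻¹-closed : ∀ g → G g → G (flip g)

module _ {n k : ℕ} {Γ : Graph (Fin n)} (M : PerfectMatching Γ k) where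
  MapsEdge : Permutation′ n → Fin k → Fin k → Set
  MapsEdge g i j =
      ((g ⟨$⟩ʳ end₁ M i ≡ end₁ M j) × (g ⟨$⟩ʳ end₂ M i ≡ end₂ M j))
    ⊎ ((g ⟨$⟩ʳ end₁ M i ≡ end₂ M j) × (g ⟨$⟩ʳ end₂ M i ≡ end₁ M j))

  Stabilizes : Permutation′ n → Set
  Stabilizes g = ∀ i → Σ (Fin k) λ j → MapsEdge g i j

  -- There is G ≤ Aut(Γ) whose setwise stabilizer G_M induces the full
  -- symmetric group S_k on the edges of M.
  Permutable : Set₁
  Permutable =
    Σ (Permutation′ n → Set) λ G → IsAutSubgroup Γ G ×
      (∀ (σ : Permutation′ k) → Σ (Permutation′ n) λ g →
         G g × Stabilizes g × (∀ i → MapsEdge g i (σ ⟨$⟩ʳ i)))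

eqb : {n : ℕ} → Fin n → Fin n → Bool
eqb u v = does (u ≟ v)

eqb-sym : {n : ℕ} (u v : Fin n) → eqb u v ≡ eqb v u
eqb-sym u v with u ≟ v | v ≟ u
... | yes _ | yes _ = refl
... | no _  | no _  = refl
... | yes p | no q  = ⊥-elim (q (≡-sym p))
... | no p  | yes q = ⊥-elim (p (≡-sym q))

eqb-refl : {n : ℕ} (u : Fin n) → eqb u u ≡ true
eqb-refl u with u ≟ u
... | yes _ = refl
... | no p  = ⊥-elim (p refl)

eqℕ-sym : (x y : ℕ) → does (x ≟ℕ y) ≡ does (y ≟ℕ x)
eqℕ-sym zero zero = refl
eqℕ-sym zero (suc y) = refl
eqℕ-sym (suc x) zero = refl
eqℕ-sym (suc x) (suc y) = eqℕ-sym x y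

eqℕ-refl : (x : ℕ) → does (x ≟ℕ x) ≡ true
eqℕ-refl zero = refl
eqℕ-refl (suc x) = eqℕ-refl x

-- Graph on two copies of Fin m (left copy A = inj₁, right copy B = inj₂):
-- A is a clique iff cA, B is a clique iff cB (otherwise edgeless),
-- and a ∈ A, b ∈ B are adjacent iff cross a b.
twoPart : (m : ℕ) (cA cB : Bool) (cross : Fin m → Fin m → Bool) →
          Graph (Fin m ⊎ Fin m)
twoPart m cA cB cross = record { adj = a ; sym = s ; irrefl = ir }
  where
  a : Fin m ⊎ Fin m → Fin m ⊎ Fin m → Bool
  a (inj₁ i) (inj₁ j) = cA ∧ not (eqb i j)
  a (inj₂ i) (inj₂ j) = cB ∧ not (eqb i j)
  a (inj₁ i) (inj₂ j) = cross i j
  a (inj₂ j) (inj₁ i) = cross i j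
  s : ∀ u v → a u v ≡ a v u
  s (inj₁ i) (inj₁ j) = cong (λ b → cA ∧ not b) (eqb-sym i j)
  s (inj₂ i) (inj₂ j) = cong (λ b → cB ∧ not b) (eqb-sym i j)
  s (inj₁ i) (inj₂ j) = refl
  s (inj₂ j) (inj₁ i) = refl
  ir : ∀ v → a v v ≡ false
  ir (inj₁ i) rewrite eqb-refl i = ∧-zeroʳ cA
  ir (inj₂ i) rewrite eqb-refl i = ∧-zeroʳ cB

allTrue : {m : ℕ} → Fin m → Fin m → Bool
allTrue _ _ = true

K2m : (m : ℕ) → Graph (Fin m ⊎ Fin m)
K2m m = twoPart m true true allTrue

KmJoinEmpty : (m : ℕ) → Graph (Fin m ⊎ Fin m)
KmJoinEmpty m = twoPart m true false allTrue

Kmm : (m : ℕ) → Graph (Fin m ⊎ Fin m)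
Kmm m = twoPart m false false allTrue

-- K_m ⊻ K_m  (two cliques joined by a perfect matching)
KmMatchKm : (m : ℕ) → Graph (Fin m ⊎ Fin m)
KmMatchKm m = twoPart m true true eqb

-- K_m ⊻ \overline{K}_m  (clique and independent set joined by a perfect matching)
KmMatchEmpty : (m : ℕ) → Graph (Fin m ⊎ Fin m)
KmMatchEmpty m = twoPart m true false eqb

C6 : Graph (Fin 6)
C6 = record { adj = a ; sym = s ; irrefl = ir }
  where
  nxt : Fin 6 → Fin 6 → Bool
  nxt i j = does (((toℕ i + 1) % 6) ≟ℕ toℕ j)
  a : Fin 6 → Fin 6 → Bool
  a i j = nxt i j ∨ nxt j i
  s : ∀ u v → a u v ≡ a v u
  s u v = ∨-comm (nxt u v) (nxt v u)
  ir : ∀ v → a v v ≡ false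
  ir zero = refl
  ir (suc zero) = refl
  ir (suc (suc zero)) = refl
  ir (suc (suc (suc zero))) = refl
  ir (suc (suc (suc (suc zero)))) = refl
  ir (suc (suc (suc (suc (suc zero))))) = refl

K6minusPM : Graph (Fin 6)
K6minusPM = record { adj = a ; sym = s ; irrefl = ir }
  where
  a : Fin 6 → Fin 6 → Bool
  a i j = not (does ((toℕ i / 2) ≟ℕ (toℕ j / 2)))
  s : ∀ u v → a u v ≡ a v u
  s u v = cong not (eqℕ-sym (toℕ u / 2) (toℕ v / 2))
  ir : ∀ v → a v v ≡ false
  ir v = cong not (eqℕ-refl (toℕ v / 2))

-- Reorienting a matching edge means exchanging its two endpoints.  An automorphism
-- group inducing S_m on the edges of M makes every 2×2 adjacency block between two distinct edges
-- a reorientation of the single block B between edges 0 and 1.  Up to reorientation B is empty,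
-- full, a row, a column, a diagonal or a corner (one entry differs from the other three).  An empty
-- B disconnects Γ, and a row or a column is not a reorientation of its transpose, as the
-- transposition of edges 0 and 1 demands.  For diagonal blocks, the parity of the offsets around a
-- triangle of edges is invariant under transpositions, so it is constant, and choosing the endpoints
-- of the edges as a coboundary of the offsets exhibits K_m ⊻ K_m or K_{m,m}.  For corner blocks,
-- whether an edge meets two other edges at the same endpoint is invariant as well: if it always
-- does, these endpoints span one side of K_m ⊻ \overline{K}_m or K_m ∨ \overline{K}_m; if it never
-- does, three values of a Boolean would be pairwise distinct as soon as m ≥ 4, and for m = 3 the
-- graph is C_6 or K_{2,2,2}.

module Submission where

open import Defs hiding (sym)
open import Data.Nat using (ℕ; zero; suc; _+_)
open import Data.Bool using (Bool; true; false; not; _∧_; _∨_; _xor_)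
open import Data.Bool.Properties
  using (not-¬; ¬-not; xor-same; xor-inverseˡ; xor-inverseʳ; xor-assoc; xor-identityʳ;
         ∧-comm; ∧-identityʳ)
import Data.Bool.Properties as Bool using (_≟_)
open import Data.Bool.Solver using (module xor-∧-Solver)
open import Data.Empty using (⊥-elim)
open import Data.Fin using (Fin; zero; suc; punchIn)
open import Data.Fin.Properties using (_≟_; all?; punchInᵢ≢i)
open import Data.Fin.Permutation using (Permutation′; _⟨$⟩ʳ_; _⟨$⟩ˡ_; inverseˡ; transpose)
open import Data.Product using (Σ; _×_; _,_; proj₁; proj₂; uncurry)
open import Data.Sum using (_⊎_; inj₁; inj₂; [_,_]; map₁)
import Data.Sum.Properties as Sum
open import Function using (_∘_; id)
open import Function.Bundles using (_↔_; Inverse; mk↔ₛ′)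
open import Function.Construct.Composition using (_↔-∘_)
open import Function.Construct.Identity using (↔-id)
open import Function.Construct.Symmetry using (↔-sym)
open import Relation.Nullary using (¬_; Dec; yes; no; does; map′; contradiction)
open import Relation.Nullary.Decidable using (dec-false; from-yes; ¬?; _×-dec_; _→-dec_)
open import Relation.Unary using (Decidable)
open import Relation.Binary.PropositionalEquality
  using (_≡_; _≢_; refl; sym; trans; cong; cong₂; subst; subst₂)
open xor-∧-Solver using (solve; _:=_; _:+_; con)

xor-cancelʳ : ∀ x y → (x xor y) xor y ≡ x
xor-cancelʳ false y = xor-same y
xor-cancelʳ true  y = xor-inverseˡ y

≢-≢⇒≡ : ∀ {a b c : Bool} → a ≢ b → a ≢ c → b ≡ c
≢-≢⇒≡ a≢b a≢c = trans (¬-not (a≢b ∘ sym)) (sym (¬-not (a≢c ∘ sym)))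

infix 4 _≐_

_≐_ : Bool → Bool → Bool
a ≐ b = not (a xor b)

≐⇒≡ : ∀ {a b} → (a ≐ b) ≡ true → a ≡ b
≐⇒≡ {false} {false} _ = refl
≐⇒≡ {true}  {true}  _ = refl

≐-false⇒≢ : ∀ {a b} → (a ≐ b) ≡ false → a ≢ b
≐-false⇒≢ {false} () refl
≐-false⇒≢ {true}  () refl

xor-≐ : ∀ s u p → (s xor u ≐ p) ≡ (s ≐ u xor p)
xor-≐ s u p = cong not (xor-assoc s u p)

xor-≐-xor : ∀ f a b → (f xor a ≐ f xor b) ≡ (a ≐ b)
xor-≐-xor f a b = cong not (solve 3 (λ f a b → (f :+ a) :+ (f :+ b) := a :+ b) refl f a b)

module _ {m : ℕ} where

  transpose-matchˡ : (a b : Fin m) → transpose a b ⟨$⟩ʳ a ≡ b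
  transpose-matchˡ a b with a ≟ a
  ... | yes _   = refl
  ... | no a≢a  = ⊥-elim (a≢a refl)

  transpose-matchʳ : (a b : Fin m) → transpose a b ⟨$⟩ʳ b ≡ a
  transpose-matchʳ a b with b ≟ a
  ... | yes refl = refl
  ... | no _ with b ≟ b
  ...   | yes _  = refl
  ...   | no b≢b = ⊥-elim (b≢b refl)

  transpose-mismatch : ∀ {a b x : Fin m} → x ≢ a → x ≢ b → transpose a b ⟨$⟩ʳ x ≡ x
  transpose-mismatch {a} {b} {x} x≢a x≢b with x ≟ a
  ... | yes x≡a = ⊥-elim (x≢a x≡a)
  ... | no _ with x ≟ b
  ...   | yes x≡b = ⊥-elim (x≢b x≡b)
  ...   | no _    = refl

  ⟨$⟩ʳ-≢ : (σ : Permutation′ m) {x y : Fin m} → x ≢ y → σ ⟨$⟩ʳ x ≢ σ ⟨$⟩ʳ y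
  ⟨$⟩ʳ-≢ σ x≢y σx≡σy = x≢y (trans (sym (inverseˡ σ)) (trans (cong (σ ⟨$⟩ˡ_) σx≡σy) (inverseˡ σ)))

  Distinct₃ : Fin m → Fin m → Fin m → Set
  Distinct₃ i j k = i ≢ j × i ≢ k × j ≢ k

  Stable₂ : (Fin m → Fin m → Set) → Set
  Stable₂ Q = ∀ a b {x y} → x ≢ y → Q x y →
              Q (transpose a b ⟨$⟩ʳ x) (transpose a b ⟨$⟩ʳ y)

  Stable₃ : (Fin m → Fin m → Fin m → Set) → Set
  Stable₃ Q = ∀ a b {x y z} → Distinct₃ x y z → Q x y z →
              Q (transpose a b ⟨$⟩ʳ x) (transpose a b ⟨$⟩ʳ y) (transpose a b ⟨$⟩ʳ z)

  stable₂-everywhere : ∀ {Q x y} → Stable₂ Q → x ≢ y → Q x y → ∀ {i j} → i ≢ j → Q i j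
  stable₂-everywhere {Q} {x} {y} stable x≢y q {i} {j} i≢j =
    subst₂ Q (transpose-mismatch i≢y₁ i≢j) (transpose-matchˡ y₁ j) (stable y₁ j i≢y₁ q₁)
    where
    y₁ : Fin m
    y₁ = transpose x i ⟨$⟩ʳ y
    q₁ : Q i y₁
    q₁ = subst (λ w → Q w y₁) (transpose-matchˡ x i) (stable x i x≢y q)
    i≢y₁ : i ≢ y₁
    i≢y₁ = subst (_≢ y₁) (transpose-matchˡ x i) (⟨$⟩ʳ-≢ (transpose x i) x≢y)

  distinct₃-⟨$⟩ʳ : (σ : Permutation′ m) {x y z : Fin m} → Distinct₃ x y z →
                   Distinct₃ (σ ⟨$⟩ʳ x) (σ ⟨$⟩ʳ y) (σ ⟨$⟩ʳ z)
  distinct₃-⟨$⟩ʳ σ (x≢y , x≢z , y≢z) = ⟨$⟩ʳ-≢ σ x≢y , ⟨$⟩ʳ-≢ σ x≢z , ⟨$⟩ʳ-≢ σ y≢z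

  -- Three transpositions move x to i, then y to j, then z to k, each fixing what is already in place.
  stable₃-everywhere : ∀ {Q x y z} → Stable₃ Q → Distinct₃ x y z → Q x y z →
                       ∀ {i j k} → Distinct₃ i j k → Q i j k
  stable₃-everywhere {Q} {x} {y} {z} stable dxyz q {i} {j} {k} (i≢j , i≢k , j≢k) =
    subst₂ (λ u w → Q u w k) (transpose-mismatch i≢z₂ i≢k) (transpose-mismatch j≢z₂ j≢k)
      (subst (Q _ _) (transpose-matchˡ z₂ k) (stable z₂ k d₂ q₂))
    where
    σ₁ : Permutation′ m
    σ₁ = transpose x i
    y₁ z₁ : Fin m
    y₁ = σ₁ ⟨$⟩ʳ y
    z₁ = σ₁ ⟨$⟩ʳ z
    σ₂ : Permutation′ m
    σ₂ = transpose y₁ j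
    z₂ : Fin m
    z₂ = σ₂ ⟨$⟩ʳ z₁
    d₁ : Distinct₃ i y₁ z₁
    d₁ = subst (λ w → Distinct₃ w y₁ z₁) (transpose-matchˡ x i) (distinct₃-⟨$⟩ʳ σ₁ dxyz)
    q₁ : Q i y₁ z₁
    q₁ = subst (λ w → Q w y₁ z₁) (transpose-matchˡ x i) (stable x i dxyz q)
    fixes-i : σ₂ ⟨$⟩ʳ i ≡ i
    fixes-i = transpose-mismatch (proj₁ d₁) i≢j
    d₂ : Distinct₃ i j z₂
    d₂ = subst₂ (λ u w → Distinct₃ u w z₂) fixes-i (transpose-matchˡ y₁ j) (distinct₃-⟨$⟩ʳ σ₂ d₁)
    q₂ : Q i j z₂
    q₂ = subst₂ (λ u w → Q u w z₂) fixes-i (transpose-matchˡ y₁ j) (stable y₁ j d₁ q₁)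
    i≢z₂ : i ≢ z₂
    i≢z₂ = proj₁ (proj₂ d₂)
    j≢z₂ : j ≢ z₂
    j≢z₂ = proj₂ (proj₂ d₂)

no-distinct₃-in-Fin2 : {i j k : Fin 2} → ¬ Distinct₃ i j k
no-distinct₃-in-Fin2 {zero}     {zero}              (i≢j , _)       = i≢j refl
no-distinct₃-in-Fin2 {suc zero} {suc zero}          (i≢j , _)       = i≢j refl
no-distinct₃-in-Fin2 {zero}     {suc zero} {zero}     (_ , i≢k , _) = i≢k refl
no-distinct₃-in-Fin2 {zero}     {suc zero} {suc zero} (_ , _ , j≢k) = j≢k refl
no-distinct₃-in-Fin2 {suc zero} {zero}     {zero}     (_ , _ , j≢k) = j≢k refl
no-distinct₃-in-Fin2 {suc zero} {zero}     {suc zero} (_ , i≢k , _) = i≢k refl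

module _ {m : ℕ} where

  Invariant₃ : (Fin m → Fin m → Fin m → Bool) → Set
  Invariant₃ I = ∀ a b {x y z} → Distinct₃ x y z →
    I (transpose a b ⟨$⟩ʳ x) (transpose a b ⟨$⟩ʳ y) (transpose a b ⟨$⟩ʳ z) ≡ I x y z

  AllTriples : (Fin m → Fin m → Fin m → Bool) → Bool → Set
  AllTriples I b = ∀ {i j k} → Distinct₃ i j k → I i j k ≡ b

  SomeTriple : Set
  SomeTriple = Σ (Fin m) λ i → Σ (Fin m) λ j → Σ (Fin m) λ k → Distinct₃ i j k

  invariant₃-constant : ∀ {I x y z} → Invariant₃ I → Distinct₃ x y z → AllTriples I (I x y z)
  invariant₃-constant {I} invariant d = stable₃-everywhere (λ a b d′ eq → trans (invariant a b d′) eq) d refl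

distinct₀₁₂ : ∀ {n} → Distinct₃ {suc (suc (suc n))} zero (suc zero) (suc (suc zero))
distinct₀₁₂ = (λ ()) , (λ ()) , (λ ())

invariant₃-dichotomy : ∀ {n} {I : Fin (suc (suc n)) → Fin (suc (suc n)) → Fin (suc (suc n)) → Bool} →
                       Invariant₃ I → AllTriples I true ⊎ (SomeTriple {suc (suc n)} × AllTriples I false)
invariant₃-dichotomy {zero} _ = inj₁ λ d → ⊥-elim (no-distinct₃-in-Fin2 d)
invariant₃-dichotomy {suc n} {I} invariant with I zero (suc zero) (suc (suc zero)) in eq
... | true  = inj₁ (subst (AllTriples I) eq (invariant₃-constant invariant distinct₀₁₂))
... | false = inj₂ ((_ , _ , _ , distinct₀₁₂) ,
                   subst (AllTriples I) eq (invariant₃-constant invariant distinct₀₁₂))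

module _ {m : ℕ} (δ : Fin m → Fin m → Bool) (z : Fin m) (c : Bool)
         (δ-sym : ∀ {i j} → i ≢ j → δ i j ≡ δ j i)
         (parity : ∀ {i j k} → Distinct₃ i j k → (δ i j xor δ j k) xor δ i k ≡ c) where

  coboundary : Σ (Fin m → Bool) λ label → ∀ {i j} → i ≢ j → (label i xor label j) xor δ i j ≡ c
  coboundary = label , λ {i} {j} → labelled i j
    where
    label : Fin m → Bool
    label i with i ≟ z
    ... | yes _ = false
    ... | no _  = δ z i xor c
    labelled : ∀ i j → i ≢ j → (label i xor label j) xor δ i j ≡ c
    labelled i j i≢j with i ≟ z | j ≟ z
    ... | yes refl | yes refl = ⊥-elim (i≢j refl)
    ... | yes refl | no _     = solve 2 (λ a c → (a :+ c) :+ a := c) refl (δ z j) c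
    ... | no i≢z   | yes refl =
      trans (cong (((δ j i xor c) xor false) xor_) (δ-sym i≢j))
            (solve 2 (λ a c → ((a :+ c) :+ con false) :+ a := c) refl (δ j i) c)
    ... | no i≢z   | no j≢z   =
      trans (solve 4 (λ a b d c → ((a :+ c) :+ (b :+ c)) :+ d := (a :+ d) :+ b) refl
                     (δ z i) (δ z j) (δ i j) c)
            (parity ((λ z≡i → i≢z (sym z≡i)) , (λ z≡j → j≢z (sym z≡j)) , i≢j))

-- 2×2 Boolean blocks
Block : Set
Block = Bool → Bool → Bool

infix 4 _≋_

_≋_ : Block → Block → Set
X ≋ Y = ∀ s t → X s t ≡ Y s t

≋-trans : ∀ {X Y Z} → X ≋ Y → Y ≋ Z → X ≋ Z
≋-trans X≋Y Y≋Z s t = trans (X≋Y s t) (Y≋Z s t)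

≋-fromValues : ∀ {X Y} → X true true ≡ Y true true → X true false ≡ Y true false →
               X false true ≡ Y false true → X false false ≡ Y false false → X ≋ Y
≋-fromValues tt tf ft ff true  true  = tt
≋-fromValues tt tf ft ff true  false = tf
≋-fromValues tt tf ft ff false true  = ft
≋-fromValues tt tf ft ff false false = ff

_ᵀ : Block → Block
(X ᵀ) s t = X t s

reorient : Bool → Bool → Block → Block
reorient u v X s t = X (s xor u) (t xor v)

reorient-≋ : ∀ {X Y} u v → X ≋ Y → reorient u v X ≋ reorient u v Y
reorient-≋ u v X≋Y s t = X≋Y (s xor u) (t xor v)

reorient-reorient : ∀ u v u′ v′ X → reorient u v (reorient u′ v′ X) ≋ reorient (u xor u′) (v xor v′) X
reorient-reorient u v u′ v′ X s t = cong₂ X (xor-assoc s u u′) (xor-assoc t v v′)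

constant : Bool → Block
constant c _ _ = c

rowBlock : Bool → Block
rowBlock c s _ = s xor c

columnBlock : Bool → Block
columnBlock c _ t = t xor c

diagonal : Bool → Block
diagonal d s t = (s xor t) xor d

corner : Bool → Bool → Bool → Block
corner c p q s t = c xor ((s ≐ p) ∧ (t ≐ q))

data Shape (X : Block) : Set where
  isConstant : ∀ c → X ≋ constant c → Shape X
  isRow      : ∀ c → X ≋ rowBlock c → Shape X
  isColumn   : ∀ c → X ≋ columnBlock c → Shape X
  isDiagonal : ∀ d → X ≋ diagonal d → Shape X
  isCorner   : ∀ c p q → X ≋ corner c p q → Shape X

shape : ∀ X → Shape X
shape X with X true true in tt | X true false in tf | X false true in ft | X false false in ff
... | false | false | false | false = isConstant false (≋-fromValues tt tf ft ff)
... | true  | true  | true  | true  = isConstant true (≋-fromValues tt tf ft ff)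
... | true  | true  | false | false = isRow false (≋-fromValues tt tf ft ff)
... | false | false | true  | true  = isRow true (≋-fromValues tt tf ft ff)
... | true  | false | true  | false = isColumn false (≋-fromValues tt tf ft ff)
... | false | true  | false | true  = isColumn true (≋-fromValues tt tf ft ff)
... | true  | false | false | true  = isDiagonal true (≋-fromValues tt tf ft ff)
... | false | true  | true  | false = isDiagonal false (≋-fromValues tt tf ft ff)
... | true  | false | false | false = isCorner false true true (≋-fromValues tt tf ft ff)
... | false | true  | false | false = isCorner false true false (≋-fromValues tt tf ft ff)
... | false | false | true  | false = isCorner false false true (≋-fromValues tt tf ft ff)
... | false | false | false | true  = isCorner false false false (≋-fromValues tt tf ft ff)
... | false | true  | true  | true  = isCorner true true true (≋-fromValues tt tf ft ff)
... | true  | false | true  | true  = isCorner true true false (≋-fromValues tt tf ft ff)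
... | true  | true  | false | true  = isCorner true false true (≋-fromValues tt tf ft ff)
... | true  | true  | true  | false = isCorner true false false (≋-fromValues tt tf ft ff)

≋diagonal-offset : ∀ {X d} → X ≋ diagonal d → X ≋ diagonal (X false false)
≋diagonal-offset {X} X≋ s t = trans (X≋ s t) (cong ((s xor t) xor_) (sym (X≋ false false)))

reorient-diagonal : ∀ u v d → reorient u v (diagonal d) ≋ diagonal ((u xor v) xor d)
reorient-diagonal u v d s t =
  solve 5 (λ u v d s t → ((s :+ u) :+ (t :+ v)) :+ d := (s :+ t) :+ ((u :+ v) :+ d)) refl u v d s t

reorient-corner : ∀ u v c p q → reorient u v (corner c p q) ≋ corner c (u xor p) (v xor q)
reorient-corner u v c p q s t = cong₂ (λ x y → c xor (x ∧ y)) (xor-≐ s u p) (xor-≐ t v q)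

corner-ᵀ : ∀ c p q → corner c p q ᵀ ≋ corner c q p
corner-ᵀ c p q s t = cong (c xor_) (∧-comm (t ≐ p) (s ≐ q))

cornerRow : Bool → Block → Bool
cornerRow c X = (c xor X true true) ∨ (c xor X true false)

cornerRow-≋ : ∀ {X Y} c → X ≋ Y → cornerRow c X ≡ cornerRow c Y
cornerRow-≋ c X≋Y = cong₂ (λ x y → (c xor x) ∨ (c xor y)) (X≋Y true true) (X≋Y true false)

cornerRow-corner : ∀ c p q → cornerRow c (corner c p q) ≡ p
cornerRow-corner false false false = refl
cornerRow-corner false false true  = refl
cornerRow-corner false true  false = refl
cornerRow-corner false true  true  = refl
cornerRow-corner true  false false = refl
cornerRow-corner true  false true  = refl
cornerRow-corner true  true  false = refl
cornerRow-corner true  true  true  = refl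

row-not-self-transposed : ∀ {X u v c} → X ᵀ ≋ reorient u v X → ¬ X ≋ rowBlock c
row-not-self-transposed {X} {u} {v} {c} Xᵀ≋ X≋row = not-¬ refl (trans c≡ (sym not-c≡))
  where
  c≡ : c ≡ u xor c
  c≡ = trans (sym (X≋row false false)) (trans (Xᵀ≋ false false) (X≋row u v))
  not-c≡ : not c ≡ u xor c
  not-c≡ = trans (sym (X≋row true false)) (trans (Xᵀ≋ false true) (X≋row u (not v)))

column-not-self-transposed : ∀ {X u v c} → X ᵀ ≋ reorient u v X → ¬ X ≋ columnBlock c
column-not-self-transposed Xᵀ≋ X≋column =
  row-not-self-transposed (λ s t → Xᵀ≋ t s) (λ s t → X≋column t s)

≅-via : ∀ {X V W : Set} {G : Graph V} {H : Graph W} (κ : X ↔ V) (τ : X ↔ W) →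
        (∀ p q → adj G (Inverse.to κ p) (Inverse.to κ q) ≡ adj H (Inverse.to τ p) (Inverse.to τ q)) →
        G ≅ H
≅-via {G = G} κ τ same = τ ↔-∘ ↔-sym κ , λ u v →
  trans (sym (same (Inverse.from κ u) (Inverse.from κ v)))
        (cong₂ (adj G) (Inverse.strictlyInverseˡ κ u) (Inverse.strictlyInverseˡ κ v))

reach-preserves : ∀ {V} {G : Graph V} (P : V → Set) → (∀ {u w} → adj G u w ≡ true → P u → P w) →
                  ∀ {u v} → Reach G u v → P u → P v
reach-preserves P step-P here           = id
reach-preserves P step-P (step uw reach) = reach-preserves P step-P reach ∘ step-P uw

side : ∀ {m} → Fin m ⊎ Fin m → Bool
side (inj₁ _) = false
side (inj₂ _) = true

edge : ∀ {m} → Fin m ⊎ Fin m → Fin m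
edge = [ id , id ]

onSide : ∀ {m} → Bool → Fin m → Fin m ⊎ Fin m
onSide false = inj₁
onSide true  = inj₂

-- Vertex inj₁ i stands for the endpoint fl i of edge i and inj₂ i for the other one.
relabel : ∀ {m} → (Fin m → Bool) → (Fin m ⊎ Fin m) ↔ (Bool × Fin m)
relabel {m} fl = mk↔ₛ′ to from to-from from-to
  where
  to : Fin m ⊎ Fin m → Bool × Fin m
  to p = side p xor fl (edge p) , edge p
  from : Bool × Fin m → Fin m ⊎ Fin m
  from (s , i) = onSide (s xor fl i) i
  to-onSide : ∀ b i → to (onSide b i) ≡ (b xor fl i , i)
  to-onSide false i = refl
  to-onSide true  i = refl
  to-from : ∀ x → to (from x) ≡ x
  to-from (s , i) = trans (to-onSide (s xor fl i) i) (cong (_, i) (xor-cancelʳ s (fl i)))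
  from-to : ∀ p → from (to p) ≡ p
  from-to (inj₁ i) = cong (λ b → onSide b i) (xor-cancelʳ false (fl i))
  from-to (inj₂ i) = cong (λ b → onSide b i) (xor-cancelʳ true (fl i))

module Matching {m : ℕ} {Γ : Graph (Fin (m + m))} (M : PerfectMatching Γ m) where

  end : Bool → Fin m → Fin (m + m)
  end true  = end₁ M
  end false = end₂ M

  block : Fin m → Fin m → Block
  block i j s t = adj Γ (end s i) (end t j)

  block-sym : ∀ i j → block j i ≋ block i j ᵀ
  block-sym i j s t = Graph.sym Γ (end s j) (end t i)

  end-adjacent : ∀ s i → adj Γ (end s i) (end (not s) i) ≡ true
  end-adjacent true  i = isEdge M i
  end-adjacent false i = trans (Graph.sym Γ _ _) (isEdge M i)

  end-incident : ∀ s i → Incident M (end s i) i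
  end-incident true  i = inj₁ refl
  end-incident false i = inj₂ refl

  end-injective : ∀ s i t j → end s i ≡ end t j → (s , i) ≡ (t , j)
  end-injective s i t j eq with cover M (end s i)
  ... | _ , _ , unique with trans (unique i (end-incident s i))
                                  (sym (unique j (subst (λ v → Incident M v j) (sym eq) (end-incident t j))))
  ...   | refl = cong (_, i) (same-edge s t eq)
    where
    loop : ∀ s → end s i ≢ end (not s) i
    loop s eq′ = contradiction
      (trans (sym (subst (λ v → adj Γ v (end (not s) i) ≡ true) eq′ (end-adjacent s i))) (irrefl Γ _)) λ ()
    same-edge : ∀ s t → end s i ≡ end t i → s ≡ t
    same-edge true  true  _  = refl
    same-edge false false _  = refl
    same-edge true  false eq = ⊥-elim (loop true eq)
    same-edge false true  eq = ⊥-elim (loop false eq)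

  endpoint : Fin (m + m) → Bool × Fin m
  endpoint v with cover M v
  ... | i , inj₁ _ , _ = true , i
  ... | i , inj₂ _ , _ = false , i

  end-endpoint : ∀ v → uncurry end (endpoint v) ≡ v
  end-endpoint v with cover M v
  ... | i , inj₁ v≡ , _ = sym v≡
  ... | i , inj₂ v≡ , _ = sym v≡

  endpoint-end : ∀ s i → endpoint (end s i) ≡ (s , i)
  endpoint-end s i = end-injective _ _ s i (end-endpoint (end s i))

  endpoints : (Bool × Fin m) ↔ Fin (m + m)
  endpoints = mk↔ₛ′ (uncurry end) endpoint end-endpoint (uncurry endpoint-end)

  sideOf : Fin (m + m) → Bool
  sideOf = proj₁ ∘ endpoint

  edgeOf : Fin (m + m) → Fin m
  edgeOf = proj₂ ∘ endpoint

  adj-block : ∀ u v → adj Γ u v ≡ block (edgeOf u) (edgeOf v) (sideOf u) (sideOf v)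
  adj-block u v = sym (cong₂ (adj Γ) (end-endpoint u) (end-endpoint v))

  blocks-empty⇒disconnected : (∀ {i j} → i ≢ j → block i j ≋ constant false) →
                              ∀ {i j} → i ≢ j → ¬ Connected Γ
  blocks-empty⇒disconnected empty {i} {j} i≢j connected =
    i≢j (trans (reach-preserves (λ v → i ≡ edgeOf v) (λ uw i≡ → trans i≡ (same-edge uw))
                  (connected (end true i) (end true j)) (edgeOf-end i))
               (sym (edgeOf-end j)))
    where
    edgeOf-end : ∀ i → i ≡ edgeOf (end true i)
    edgeOf-end i = sym (cong proj₂ (endpoint-end true i))
    same-edge : ∀ {u w} → adj Γ u w ≡ true → edgeOf u ≡ edgeOf w
    same-edge {u} {w} uw with edgeOf u ≟ edgeOf w
    ... | yes same = same
    ... | no differ =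
      contradiction (trans (sym uw) (trans (adj-block u w) (empty differ (sideOf u) (sideOf w)))) λ ()

  Labelling : (Fin m → Fin m → Block) → Set
  Labelling F = Σ (Fin m → Bool) λ fl → ∀ {i j} → i ≢ j → reorient (fl i) (fl j) (block i j) ≋ F i j

  labelled-iso : ∀ {F} → Labelling F → {W : Set} (H : Graph W) (τ : (Fin m ⊎ Fin m) ↔ W) →
                 (∀ i → adj H (Inverse.to τ (inj₁ i)) (Inverse.to τ (inj₂ i)) ≡ true) →
                 (∀ p q → edge p ≢ edge q →
                    F (edge p) (edge q) (side p) (side q) ≡ adj H (Inverse.to τ p) (Inverse.to τ q)) →
                 Γ ≅ H
  labelled-iso (fl , described) H τ matched realised = ≅-via {G = Γ} {H = H} (endpoints ↔-∘ relabel fl) τ same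
    where
    same : ∀ p q → block (edge p) (edge q) (side p xor fl (edge p)) (side q xor fl (edge q))
                   ≡ adj H (Inverse.to τ p) (Inverse.to τ q)
    same p q with edge p ≟ edge q
    same p q | no differ = trans (described differ (side p) (side q)) (realised p q differ)
    same (inj₁ i) (inj₁ _) | yes refl = trans (irrefl Γ _) (sym (irrefl H _))
    same (inj₂ i) (inj₂ _) | yes refl = trans (irrefl Γ _) (sym (irrefl H _))
    same (inj₁ i) (inj₂ _) | yes refl = trans (end-adjacent (fl i) i) (sym (matched i))
    same (inj₂ i) (inj₁ _) | yes refl =
      trans (Graph.sym Γ _ _) (trans (end-adjacent (fl i) i) (trans (sym (matched i)) (Graph.sym H _ _)))

  twoPart-iso : (F : Block) (cross : Fin m → Fin m → Bool) →
                (∀ i → cross i i ≡ true) → (∀ {i j} → i ≢ j → cross i j ≡ F false true) →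
                F true false ≡ F false true → Labelling (λ _ _ → F) →
                Γ ≅ twoPart m (F false false) (F true true) cross
  twoPart-iso F cross cross-diag cross-off F-sym labelling =
    labelled-iso labelling H (↔-id _) cross-diag realised
    where
    H : Graph (Fin m ⊎ Fin m)
    H = twoPart m (F false false) (F true true) cross
    realised : ∀ p q → edge p ≢ edge q → F (side p) (side q) ≡ adj H p q
    realised (inj₁ i) (inj₁ j) i≢j =
      sym (trans (cong (λ b → F false false ∧ not b) (dec-false (i ≟ j) i≢j)) (∧-identityʳ _))
    realised (inj₂ i) (inj₂ j) i≢j =
      sym (trans (cong (λ b → F true true ∧ not b) (dec-false (i ≟ j) i≢j)) (∧-identityʳ _))
    realised (inj₁ i) (inj₂ j) i≢j = sym (cross-off i≢j)
    realised (inj₂ j) (inj₁ i) j≢i = trans F-sym (sym (cross-off (j≢i ∘ sym)))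

  complete-iso : (∀ {i j} → i ≢ j → block i j ≋ constant true) → Γ ≅ K2m m
  complete-iso full = twoPart-iso (constant true) allTrue (λ _ → refl) (λ _ → refl) refl
                        ((λ _ → false) , λ i≢j s t → full i≢j (s xor false) (t xor false))

Classified : (m : ℕ) → Graph (Fin (m + m)) → Set
Classified m Γ = (Γ ≅ K2m m) ⊎ (Γ ≅ KmJoinEmpty m) ⊎ (Γ ≅ Kmm m) ⊎ (Γ ≅ KmMatchKm m) ⊎
                 (Γ ≅ KmMatchEmpty m) ⊎ (Γ ≅ C6) ⊎ (Γ ≅ K6minusPM)

module Symmetry {m : ℕ} {Γ : Graph (Fin (m + m))} (M : PerfectMatching Γ m) (P : Permutable M) where
  open Matching M

  block-symmetry : (σ : Permutation′ m) → Σ (Fin m → Bool) λ f →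
                   ∀ i j → block (σ ⟨$⟩ʳ i) (σ ⟨$⟩ʳ j) ≋ reorient (f i) (f j) (block i j)
  block-symmetry σ with proj₂ (proj₂ P) σ
  ... | g , g∈G , _ , maps = f , λ i j s t →
    trans (cong₂ (adj Γ) (moved s i) (moved t j)) (IsAutSubgroup.⊆Aut (proj₁ (proj₂ P)) g g∈G _ _)
    where
    f : Fin m → Bool
    f i = [ (λ _ → false) , (λ _ → true) ] (maps i)
    g-end : ∀ s i → g ⟨$⟩ʳ end s i ≡ end (s xor f i) (σ ⟨$⟩ʳ i)
    g-end s i with maps i
    g-end true  i | inj₁ (g₁ , _) = g₁
    g-end false i | inj₁ (_ , g₂) = g₂
    g-end true  i | inj₂ (g₁ , _) = g₁
    g-end false i | inj₂ (_ , g₂) = g₂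
    moved : ∀ s i → end s (σ ⟨$⟩ʳ i) ≡ g ⟨$⟩ʳ end (s xor f i) i
    moved s i = sym (trans (g-end (s xor f i) i) (cong (λ b → end b (σ ⟨$⟩ʳ i)) (xor-cancelʳ s (f i))))

module _ {m : ℕ} {Γ : Graph (Fin (m + m))} (M : PerfectMatching Γ m) where
  open Matching M

  record Exceptional : Set where
    field
      c : Bool
      π : Fin m → Fin m → Bool
      block-corner : ∀ {i j} → i ≢ j → block i j ≋ corner c (π i j) (π j i)
      rows-differ : ∀ {i j k} → Distinct₃ i j k → π i j ≢ π i k
      triple : SomeTriple {m}

-- Classification for at least two edges

module Classification {k : ℕ} {Γ : Graph (Fin (suc (suc k) + suc (suc k)))}
                      (M : PerfectMatching Γ (suc (suc k))) (P : Permutable M) where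
  open Matching M
  open Symmetry M P

  m : ℕ
  m = suc (suc k)

  0≢1 : _≢_ {A = Fin m} zero (suc zero)
  0≢1 ()

  B : Block
  B = block zero (suc zero)

  B-spread : ∀ {i j} → i ≢ j → Σ Bool λ u → Σ Bool λ v → block i j ≋ reorient u v B
  B-spread = stable₂-everywhere stable 0≢1
               (false , false , λ s t → sym (cong₂ B (xor-identityʳ s) (xor-identityʳ t)))
    where
    stable : Stable₂ λ i j → Σ Bool λ u → Σ Bool λ v → block i j ≋ reorient u v B
    stable a b {x} {y} _ (u , v , x≋) with block-symmetry (transpose a b)
    ... | f , moved = f x xor u , f y xor v ,
          ≋-trans (moved x y) (≋-trans (reorient-≋ (f x) (f y) x≋) (reorient-reorient (f x) (f y) u v B))

  B-self-transposed : Σ Bool λ u → Σ Bool λ v → B ᵀ ≋ reorient u v B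
  B-self-transposed with block-symmetry (transpose zero (suc zero))
  ... | f , moved = f zero , f (suc zero) , λ s t →
    trans (sym (block-sym zero (suc zero) s t))
          (trans (cong₂ (λ i j → block i j s t) (sym (transpose-matchˡ zero (suc zero)))
                                               (sym (transpose-matchʳ zero (suc zero))))
                 (moved zero (suc zero) s t))

  module Diagonal (d : Bool) (B≋ : B ≋ diagonal d) where
    δ : Fin m → Fin m → Bool
    δ i j = block i j false false

    block-diagonal : ∀ {i j} → i ≢ j → block i j ≋ diagonal (δ i j)
    block-diagonal i≢j with B-spread i≢j
    ... | u , v , spread =
      ≋diagonal-offset (≋-trans spread (≋-trans (reorient-≋ u v B≋) (reorient-diagonal u v d)))

    parity : Fin m → Fin m → Fin m → Bool
    parity i j k = (δ i j xor δ j k) xor δ i k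

    parity-invariant : Invariant₃ parity
    parity-invariant a b {x} {y} {z} (x≢y , x≢z , y≢z) with block-symmetry (transpose a b)
    ... | f , moved = trans (cong₂ (λ p q → p xor q) (cong₂ _xor_ (δ-moved x≢y) (δ-moved y≢z)) (δ-moved x≢z))
        (solve 6 (λ a b c p q r → ((a :+ b) :+ p :+ ((b :+ c) :+ q)) :+ ((a :+ c) :+ r) := (p :+ q) :+ r)
                 refl (f x) (f y) (f z) (δ x y) (δ y z) (δ x z))
      where
      δ-moved : ∀ {x y} → x ≢ y → δ (transpose a b ⟨$⟩ʳ x) (transpose a b ⟨$⟩ʳ y) ≡ (f x xor f y) xor δ x y
      δ-moved {x} {y} x≢y = trans (moved x y false false) (block-diagonal x≢y (f x) (f y))

    parity-constant : Σ Bool (AllTriples parity)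
    parity-constant with invariant₃-dichotomy parity-invariant
    ... | inj₁ all       = true , all
    ... | inj₂ (_ , all) = false , all

    diagonal-labelling : Σ Bool λ c → Labelling λ _ _ → diagonal c
    diagonal-labelling with parity-constant
    ... | c , all with coboundary δ zero c (λ {i} {j} _ → sym (block-sym i j false false)) all
    ...   | fl , cob = c , fl , λ {i} {j} i≢j →
            ≋-trans (reorient-≋ (fl i) (fl j) (block-diagonal i≢j))
                    (≋-trans (reorient-diagonal (fl i) (fl j) (δ i j))
                             (λ s t → cong ((s xor t) xor_) (cob i≢j)))

  module Corner (c p₀ q₀ : Bool) (B≋ : B ≋ corner c p₀ q₀) where
    π : Fin m → Fin m → Bool
    π i j = cornerRow c (block i j)

    block-corner : ∀ {i j} → i ≢ j → block i j ≋ corner c (π i j) (π j i)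
    block-corner {i} {j} i≢j with B-spread i≢j
    ... | u , v , spread = subst₂ (λ p q → block i j ≋ corner c p q) (sym row) (sym column) X≋
      where
      X≋ : block i j ≋ corner c (u xor p₀) (v xor q₀)
      X≋ = ≋-trans spread (≋-trans (reorient-≋ u v B≋) (reorient-corner u v c p₀ q₀))
      row : π i j ≡ u xor p₀
      row = trans (cornerRow-≋ c X≋) (cornerRow-corner c _ _)
      column : π j i ≡ v xor q₀
      column = trans (cornerRow-≋ c (≋-trans (block-sym i j) (≋-trans (λ s t → X≋ t s) (corner-ᵀ c _ _))))
                     (cornerRow-corner c _ _)

    agreement : Fin m → Fin m → Fin m → Bool
    agreement i j k = π i j ≐ π i k

    agreement-invariant : Invariant₃ agreement
    agreement-invariant a b {x} {y} {z} (x≢y , x≢z , _) with block-symmetry (transpose a b)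
    ... | f , moved = trans (cong₂ _≐_ (π-moved x≢y) (π-moved x≢z)) (xor-≐-xor (f x) (π x y) (π x z))
      where
      π-moved : ∀ {x y} → x ≢ y → π (transpose a b ⟨$⟩ʳ x) (transpose a b ⟨$⟩ʳ y) ≡ f x xor π x y
      π-moved {x} {y} x≢y =
        trans (cornerRow-≋ c (≋-trans (moved x y) (≋-trans (reorient-≋ (f x) (f y) (block-corner x≢y))
                                                              (reorient-corner (f x) (f y) c _ _))))
              (cornerRow-corner c _ _)

    module Consistent (consistent : AllTriples agreement true) where
      other : Fin m → Fin m
      other i = punchIn i zero

      π-row : ∀ {i j} → i ≢ j → π i j ≡ π i (other i)
      π-row {i} {j} i≢j with j ≟ other i
      ... | yes refl = refl
      ... | no j≢other = ≐⇒≡ (consistent (i≢j , (λ eq → punchInᵢ≢i i zero (sym eq)) , j≢other))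

      -- Consistency means that all blocks at edge i single out its endpoint π i (other i); that endpoint
      -- is put into the first copy of Fin m exactly when c = false.
      corner-labelling : Labelling λ _ _ → corner c c c
      corner-labelling = fl , λ {i} {j} i≢j →
        ≋-trans (reorient-≋ (fl i) (fl j) (block-corner i≢j))
                (≋-trans (reorient-corner (fl i) (fl j) c _ _)
                         (λ s t → cong₂ (λ p q → corner c p q s t)
                                        (singled-out i≢j) (singled-out (i≢j ∘ sym))))
        where
        fl : Fin m → Bool
        fl i = c xor π i (other i)
        singled-out : ∀ {i j} → i ≢ j → fl i xor π i j ≡ c
        singled-out {i} i≢j = trans (cong (fl i xor_) (π-row i≢j)) (xor-cancelʳ c (π i (other i)))

    corner-dichotomy : Labelling (λ _ _ → corner c c c) ⊎ Exceptional M
    corner-dichotomy with invariant₃-dichotomy agreement-invariant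
    ... | inj₁ consistent = inj₁ (Consistent.corner-labelling consistent)
    ... | inj₂ (triple , inconsistent) =
      inj₂ (record { c = c ; π = π ; block-corner = block-corner
                   ; rows-differ = ≐-false⇒≢ ∘ inconsistent ; triple = triple })

  blocks-constant : ∀ {b} → B ≋ constant b → ∀ {i j} → i ≢ j → block i j ≋ constant b
  blocks-constant B≋ i≢j with B-spread i≢j
  ... | u , v , spread = ≋-trans spread (reorient-≋ u v B≋)

  diagonal-iso : (Σ Bool λ c → Labelling λ _ _ → diagonal c) → Classified m Γ
  diagonal-iso (true , labelling)  = inj₂ (inj₂ (inj₂ (inj₁
    (twoPart-iso (diagonal true) eqb eqb-refl (dec-false (_ ≟ _)) refl labelling))))
  diagonal-iso (false , labelling) = inj₂ (inj₂ (inj₁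
    (twoPart-iso (diagonal false) allTrue (λ _ → refl) (λ _ → refl) refl labelling)))

  corner-iso : ∀ c → Labelling (λ _ _ → corner c c c) → Classified m Γ
  corner-iso false labelling = inj₂ (inj₂ (inj₂ (inj₂ (inj₁
    (twoPart-iso (corner false false false) eqb eqb-refl (dec-false (_ ≟ _)) refl labelling)))))
  corner-iso true  labelling = inj₂ (inj₁
    (twoPart-iso (corner true true true) allTrue (λ _ → refl) (λ _ → refl) refl labelling))

  classify : Connected Γ → Classified m Γ ⊎ Exceptional M
  classify connected with shape B
  ... | isConstant false B≋ = ⊥-elim (blocks-empty⇒disconnected (blocks-constant B≋) 0≢1 connected)
  ... | isConstant true B≋  = inj₁ (inj₁ (complete-iso (blocks-constant B≋)))
  ... | isRow _ B≋          = ⊥-elim (row-not-self-transposed (proj₂ (proj₂ B-self-transposed)) B≋)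
  ... | isColumn _ B≋       = ⊥-elim (column-not-self-transposed (proj₂ (proj₂ B-self-transposed)) B≋)
  ... | isDiagonal d B≋     = inj₁ (diagonal-iso (Diagonal.diagonal-labelling d B≋))
  ... | isCorner c p q B≋   = map₁ (corner-iso c) (Corner.corner-dichotomy c p q B≋)

-- Three edges

all⊎? : ∀ {n p} {P : Fin n ⊎ Fin n → Set p} → Decidable P → Dec (∀ x → P x)
all⊎? P? = map′ (λ (l , r) → [ l , r ]) (λ all → all ∘ inj₁ , all ∘ inj₂)
                (all? (P? ∘ inj₁) ×-dec all? (P? ∘ inj₂))

next : Fin 3 → Fin 3
next zero             = suc zero
next (suc zero)       = suc (suc zero)
next (suc (suc zero)) = zero

isNext : Fin 3 → Fin 3 → Bool
isNext i j = does (next i ≟ j)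

next-≢ : ∀ i → i ≢ next i
next-≢ zero             ()
next-≢ (suc zero)       ()
next-≢ (suc (suc zero)) ()

-- In the labelling by π i (next i), edge i meets edge next i at its first endpoint and the third
-- edge at its second one.
threeCycleBlock : Bool → Fin 3 → Fin 3 → Block
threeCycleBlock c i j = corner c (not (isNext i j)) (not (isNext j i))

hexagon : (Fin 3 ⊎ Fin 3) ↔ Fin 6
hexagon = mk↔ₛ′ to from (from-yes (all? λ y → to (from y) ≟ y))
                        (from-yes (all⊎? λ x → Sum.≡-dec _≟_ _≟_ (from (to x)) x))
  where
  to : Fin 3 ⊎ Fin 3 → Fin 6
  to (inj₁ zero)             = zero
  to (inj₂ (suc zero))       = suc zero
  to (inj₁ (suc zero))       = suc (suc zero)
  to (inj₂ (suc (suc zero))) = suc (suc (suc zero))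
  to (inj₁ (suc (suc zero))) = suc (suc (suc (suc zero)))
  to (inj₂ zero)             = suc (suc (suc (suc (suc zero))))
  from : Fin 6 → Fin 3 ⊎ Fin 3
  from zero                                = inj₁ zero
  from (suc zero)                          = inj₂ (suc zero)
  from (suc (suc zero))                    = inj₁ (suc zero)
  from (suc (suc (suc zero)))              = inj₂ (suc (suc zero))
  from (suc (suc (suc (suc zero))))        = inj₁ (suc (suc zero))
  from (suc (suc (suc (suc (suc zero))))) = inj₂ zero

Realises : Bool → Graph (Fin 6) → Set
Realises c H = (∀ i → adj H (to (inj₁ i)) (to (inj₂ i)) ≡ true) ×
               (∀ p q → edge p ≢ edge q →
                  threeCycleBlock c (edge p) (edge q) (side p) (side q) ≡ adj H (to p) (to q))
  where open Inverse hexagon using (to)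

realises? : ∀ c H → Dec (Realises c H)
realises? c H = all? (λ i → adj H _ _ Bool.≟ true) ×-dec
                all⊎? (λ p → all⊎? λ q → ¬? (edge p ≟ edge q) →-dec (_ Bool.≟ _))

C6-realises : Realises false C6
C6-realises = from-yes (realises? false C6)

K6minusPM-realises : Realises true K6minusPM
K6minusPM-realises = from-yes (realises? true K6minusPM)

module ThreeEdges {Γ : Graph (Fin (3 + 3))} {M : PerfectMatching Γ 3} (exceptional : Exceptional M) where
  open Matching M
  open Exceptional exceptional

  π-next : ∀ {i j} → i ≢ j → π i (next i) xor π i j ≡ not (isNext i j)
  π-next {i} {j} i≢j with next i ≟ j
  ... | yes refl     = xor-same (π i (next i))
  ... | no next≢j = trans (cong (π i (next i) xor_) (¬-not (rows-differ (next-≢ i , i≢j , next≢j) ∘ sym)))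
                          (xor-inverseʳ (π i (next i)))

  three-cycle-labelling : Labelling (threeCycleBlock c)
  three-cycle-labelling = (λ i → π i (next i)) , λ i≢j →
    ≋-trans (reorient-≋ _ _ (block-corner i≢j))
            (≋-trans (reorient-corner _ _ c _ _)
                     (λ s t → cong₂ (λ p q → corner c p q s t) (π-next i≢j) (π-next (i≢j ∘ sym))))

  realised : ∀ {c′} H → c ≡ c′ → Realises c′ H → Γ ≅ H
  realised H refl (matched , distinct) =
    labelled-iso three-cycle-labelling H hexagon matched distinct

  three-edges-iso : (Γ ≅ C6) ⊎ (Γ ≅ K6minusPM)
  three-edges-iso with c in eq
  ... | false = inj₁ (realised C6 eq C6-realises)
  ... | true  = inj₂ (realised K6minusPM eq K6minusPM-realises)

exceptional-case : ∀ {k} {Γ : Graph (Fin (suc (suc k) + suc (suc k)))} {M : PerfectMatching Γ (suc (suc k))} →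
                   Exceptional M → Classified (suc (suc k)) Γ
exceptional-case {zero} exceptional = ⊥-elim (no-distinct₃-in-Fin2 (proj₂ (proj₂ (proj₂ triple))))
  where open Exceptional exceptional
exceptional-case {suc zero} exceptional with ThreeEdges.three-edges-iso exceptional
... | inj₁ ≅C6        = inj₂ (inj₂ (inj₂ (inj₂ (inj₂ (inj₁ ≅C6)))))
... | inj₂ ≅K6minusPM = inj₂ (inj₂ (inj₂ (inj₂ (inj₂ (inj₂ ≅K6minusPM)))))
exceptional-case {suc (suc k)} exceptional =
  ⊥-elim (rows-differ d₀₂₃ (≢-≢⇒≡ (rows-differ d₀₁₂) (rows-differ d₀₁₃)))
  where
  open Exceptional exceptional
  d₀₁₂ : Distinct₃ {4 + k} zero (suc zero) (suc (suc zero))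
  d₀₁₂ = distinct₀₁₂
  d₀₁₃ : Distinct₃ {4 + k} zero (suc zero) (suc (suc (suc zero)))
  d₀₁₃ = (λ ()) , (λ ()) , (λ ())
  d₀₂₃ : Distinct₃ {4 + k} zero (suc (suc zero)) (suc (suc (suc zero)))
  d₀₂₃ = (λ ()) , (λ ()) , (λ ())

corollary1p4 : (m : ℕ) (Γ : Graph (Fin (m + m))) → Connected Γ →
    (M : PerfectMatching Γ m) → Permutable M →
    (Γ ≅ K2m m) ⊎ (Γ ≅ KmJoinEmpty m) ⊎ (Γ ≅ Kmm m) ⊎ (Γ ≅ KmMatchKm m) ⊎
    (Γ ≅ KmMatchEmpty m) ⊎ (Γ ≅ C6) ⊎ (Γ ≅ K6minusPM)
corollary1p4 zero          Γ _         M _ = inj₁ (Matching.complete-iso M λ { {()} })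
corollary1p4 (suc zero)    Γ _         M _ =
  inj₁ (Matching.complete-iso M λ { {zero} {zero} 0≢0 → ⊥-elim (0≢0 refl) })
corollary1p4 (suc (suc k)) Γ connected M P with Classification.classify M P connected
... | inj₁ classified  = classified
... | inj₂ exceptional = exceptional-case exceptional
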